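{- If $k \ge 1$ is an integer, then $\gamma_t(C_{6k+1}\,\square\, K_2) = 2\gamma(C_{6k+1}) - 1$.
   Context: $C_m$ is the cycle on $m$ vertices. $G\,\square\,K_2$ is the Cartesian product of $G$ with $K_2$ (the prism of $G$): two copies of $G$ with each vertex joined to its copy. $\gamma(G)$ is the domination number (minimum size of a set $S$ such that every vertex outside $S$ has a neighbor in $S$) and $\gamma_t(G)$ is the total domination number (minimum size of a set $S$ such that every vertex of the graph has a neighbor in $S$). -}

module Defs where

open import Data.Nat using (ℕ; zero; suc; _+_; _*_; _∸_; _≤_; NonZero)
open import Data.Nat.DivMod using (_%_)
open import Data.Fin using (Fin; toℕ)
open import Data.Sum using (_⊎_; inj₁; inj₂)
open import Data.Bool using (Bool; true; false; T)
open import Data.List using (List; map; _++_; filter; length; allFin)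
open import Data.Product using (Σ; ∃; _×_; _,_)
open import Relation.Binary.PropositionalEquality using (_≡_)
open import Data.Bool.Properties using (T?)

record Graph : Set₁ where
  field
    V     : Set
    verts : List V          -- enumeration of all vertices (each exactly once)
    Adj   : V → V → Set

open Graph public

VSet : Graph → Set
VSet G = V G → Bool

size : (G : Graph) → VSet G → ℕ
size G S = length (filter (λ v → T? (S v)) (verts G))

Dominating : (G : Graph) → VSet G → Set
Dominating G S = ∀ v → T (S v) ⊎ (∃ λ u → T (S u) × Adj G v u)

TotalDominating : (G : Graph) → VSet G → Set
TotalDominating G S = ∀ v → ∃ λ u → T (S u) × Adj G v u

IsDominationNumber : Graph → ℕ → Set
IsDominationNumber G k =
  (∃ λ S → Dominating G S × size G S ≡ k) ×
  (∀ S → Dominating G S → k ≤ size G S)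

IsTotalDominationNumber : Graph → ℕ → Set
IsTotalDominationNumber G k =
  (∃ λ S → TotalDominating G S × size G S ≡ k) ×
  (∀ S → TotalDominating G S → k ≤ size G S)

-- The cycle C_m on vertices 0..m-1 (intended for m ≥ 3): i ~ j iff j ≡ i+1 or i ≡ j+1 (mod m).
Cycle : (m : ℕ) → .{{NonZero m}} → Graph
Cycle m = record
  { V     = Fin m
  ; verts = allFin m
  ; Adj   = λ i j → ((toℕ i + 1) % m ≡ toℕ j) ⊎ ((toℕ j + 1) % m ≡ toℕ i)
  }

data PrismAdj (G : Graph) : V G ⊎ V G → V G ⊎ V G → Set where
  left  : ∀ {u v} → Adj G u v → PrismAdj G (inj₁ u) (inj₁ v)
  right : ∀ {u v} → Adj G u v → PrismAdj G (inj₂ u) (inj₂ v)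
  rung₁ : ∀ {u} → PrismAdj G (inj₁ u) (inj₂ u)
  rung₂ : ∀ {u} → PrismAdj G (inj₂ u) (inj₁ u)

Prism : Graph → Graph
Prism G = record
  { V     = V G ⊎ V G
  ; verts = map inj₁ (verts G) ++ map inj₂ (verts G)
  ; Adj   = PrismAdj G
  }

-- In C_n every vertex lies in exactly three closed neighbourhoods, and in the prism C_n □ K₂
-- every vertex lies in exactly three open neighbourhoods.  Summing the (total) domination
-- condition over all vertices therefore gives n ≤ 3|S| for a dominating set of C_n and
-- 2n ≤ 3|S| for a total dominating set of the prism; for n = 6k+1 this means γ(C_n) ≥ 2k+1 and
-- γ_t(C_n □ K₂) ≥ 4k+1.  Both bounds are attained: by every third vertex of the cycle, and by
-- the vertices ≡ 0, 1 (mod 6) of one copy together with the vertices ≡ 3, 4 (mod 6) of the other.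
module Submission where

open import Defs
open import Data.Nat using (ℕ; suc; _≤_; _+_; _*_; _∸_)
open import Data.Product using (∃; _×_)

open import Data.Bool using (Bool; true; false; T)
open import Data.Bool.Properties using (T?)
open import Data.Empty using (⊥-elim)
open import Data.Fin using (Fin; toℕ; fromℕ; fromℕ<; inject₁)
open import Data.Fin.Patterns using (0F; 1F; 2F; 3F; 4F; 5F)
open import Data.Fin.Properties using (toℕ-injective; toℕ<n; toℕ-fromℕ<; toℕ-fromℕ; toℕ-inject₁)
open import Data.List using (List; []; _∷_; map; _++_; filter; length; tabulate)
open import Data.List.Properties using (filter-++; length-++)
open import Data.Nat using (zero; _<_; s≤s; z≤n; _%_; NonZero)
open import Data.Nat.DivMod
  using (_divMod_; result; m%n<n; m%n%n≡m%n; %-distribˡ-+; [m+n]%n≡m%n; [m+kn]%n≡m%n; m*n%n≡0; n%n≡0; m<n⇒m%n≡m)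
open import Data.Nat.Divisibility using (_∣_; divides)
open import Data.Nat.Properties
open import Algebra.Properties.CommutativeMonoid.Sum +-0-commutativeMonoid
  using (sum-syntax; ∑-distrib-+; sum-init-last; sum-cong-≗)
open import Data.Nat.Tactic.RingSolver using (solve-∀)
open import Data.Product using (_,_)
open import Data.Sum using (_⊎_; inj₁; inj₂)
open import Data.Unit using (tt)
open import Function using (_∘_; id)
open import Relation.Binary.PropositionalEquality
open import Relation.Nullary using (yes; no)

indicator : Bool → ℕ
indicator true  = 1
indicator false = 0

T⇒indicator≡1 : ∀ {b} → T b → indicator b ≡ 1
T⇒indicator≡1 {true} _ = refl

T⇒1≤n+indicator : ∀ {b} n → T b → 1 ≤ n + indicator b
T⇒1≤n+indicator n t = ≤-trans (≤-reflexive (sym (T⇒indicator≡1 t))) (m≤n+m _ n)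

count-tabulate : ∀ {A : Set} {n} (S : A → Bool) (f : Fin n → A) →
  length (filter (λ v → T? (S v)) (tabulate f)) ≡ ∑[ i < n ] indicator (S (f i))
count-tabulate {n = zero}  S f = refl
count-tabulate {n = suc n} S f with S (f 0F)
... | true  = cong suc (count-tabulate S (f ∘ Fin.suc))
... | false = count-tabulate S (f ∘ Fin.suc)

length-filter-map : ∀ {A B : Set} (S : B → Bool) (f : A → B) (xs : List A) →
  length (filter (λ w → T? (S w)) (map f xs)) ≡ length (filter (λ v → T? (S (f v))) xs)
length-filter-map S f []       = refl
length-filter-map S f (x ∷ xs) with S (f x)
... | true  = cong suc (length-filter-map S f xs)
... | false = length-filter-map S f xs

size-Cycle : ∀ m (S : VSet (Cycle (suc m))) →
  size (Cycle (suc m)) S ≡ ∑[ v < suc m ] indicator (S v)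
size-Cycle m S = count-tabulate S id

size-Prism : ∀ G (S : VSet (Prism G)) →
  size (Prism G) S ≡ size G (S ∘ inj₁) + size G (S ∘ inj₂)
size-Prism G S = begin
  length (filter P? (map inj₁ (verts G) ++ map inj₂ (verts G)))
    ≡⟨ cong length (filter-++ P? (map inj₁ (verts G)) (map inj₂ (verts G))) ⟩
  length (filter P? (map inj₁ (verts G)) ++ filter P? (map inj₂ (verts G)))
    ≡⟨ length-++ (filter P? (map inj₁ (verts G))) ⟩
  length (filter P? (map inj₁ (verts G))) + length (filter P? (map inj₂ (verts G)))
    ≡⟨ cong₂ _+_ (length-filter-map S inj₁ (verts G)) (length-filter-map S inj₂ (verts G)) ⟩
  size G (S ∘ inj₁) + size G (S ∘ inj₂)
    ∎
  where
  open ≡-Reasoning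
  P? = λ w → T? (S w)

[m%n+k]%n≡[m+k]%n : ∀ m k n .{{_ : NonZero n}} → (m % n + k) % n ≡ (m + k) % n
[m%n+k]%n≡[m+k]%n m k n = begin
  (m % n + k) % n         ≡⟨ %-distribˡ-+ (m % n) k n ⟩
  (m % n % n + k % n) % n ≡⟨ cong (λ x → (x + k % n) % n) (m%n%n≡m%n m n) ⟩
  (m % n + k % n) % n     ≡⟨ %-distribˡ-+ m k n ⟨
  (m + k) % n             ∎
  where open ≡-Reasoning

module _ {m : ℕ} where

  next prev : Fin (suc m) → Fin (suc m)
  next v = fromℕ< (m%n<n (toℕ v + 1) (suc m))
  prev v = fromℕ< (m%n<n (toℕ v + m) (suc m))

  toℕ-next : ∀ v → toℕ (next v) ≡ (toℕ v + 1) % suc m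
  toℕ-next v = toℕ-fromℕ< _

  toℕ-prev : ∀ v → toℕ (prev v) ≡ (toℕ v + m) % suc m
  toℕ-prev v = toℕ-fromℕ< _

  private
    [v+n]%n≡v : ∀ (v : Fin (suc m)) → (toℕ v + suc m) % suc m ≡ toℕ v
    [v+n]%n≡v v = trans ([m+n]%n≡m%n (toℕ v) (suc m)) (m<n⇒m%n≡m (toℕ<n v))

  prev-next : ∀ v → prev (next v) ≡ v
  prev-next v = toℕ-injective (begin
    toℕ (prev (next v))               ≡⟨ trans (toℕ-prev (next v)) (cong (λ x → (x + m) % suc m) (toℕ-next v)) ⟩
    ((toℕ v + 1) % suc m + m) % suc m ≡⟨ [m%n+k]%n≡[m+k]%n (toℕ v + 1) m (suc m) ⟩
    (toℕ v + 1 + m) % suc m           ≡⟨ cong (_% suc m) (+-assoc (toℕ v) 1 m) ⟩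
    (toℕ v + suc m) % suc m           ≡⟨ [v+n]%n≡v v ⟩
    toℕ v                             ∎)
    where open ≡-Reasoning

  next-prev : ∀ v → next (prev v) ≡ v
  next-prev v = toℕ-injective (begin
    toℕ (next (prev v))               ≡⟨ trans (toℕ-next (prev v)) (cong (λ x → (x + 1) % suc m) (toℕ-prev v)) ⟩
    ((toℕ v + m) % suc m + 1) % suc m ≡⟨ [m%n+k]%n≡[m+k]%n (toℕ v + m) 1 (suc m) ⟩
    (toℕ v + m + 1) % suc m           ≡⟨ cong (_% suc m) (trans (+-assoc (toℕ v) m 1) (cong (toℕ v +_) (+-comm m 1))) ⟩
    (toℕ v + suc m) % suc m           ≡⟨ [v+n]%n≡v v ⟩
    toℕ v                             ∎)
    where open ≡-Reasoning

  toℕ-next-≢ : ∀ {v} → toℕ v ≢ m → toℕ (next v) ≡ suc (toℕ v)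
  toℕ-next-≢ {v} v≢m = begin
    toℕ (next v)        ≡⟨ toℕ-next v ⟩
    (toℕ v + 1) % suc m ≡⟨ cong (_% suc m) (+-comm (toℕ v) 1) ⟩
    suc (toℕ v) % suc m ≡⟨ m<n⇒m%n≡m (s≤s (≤∧≢⇒< (≤-pred (toℕ<n v)) v≢m)) ⟩
    suc (toℕ v)         ∎
    where open ≡-Reasoning

  toℕ-next-≡ : ∀ {v} → toℕ v ≡ m → toℕ (next v) ≡ 0
  toℕ-next-≡ {v} v≡m = begin
    toℕ (next v)        ≡⟨ toℕ-next v ⟩
    (toℕ v + 1) % suc m ≡⟨ cong (_% suc m) (trans (cong (_+ 1) v≡m) (+-comm m 1)) ⟩
    suc m % suc m       ≡⟨ n%n≡0 (suc m) ⟩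
    0                   ∎
    where open ≡-Reasoning

  toℕ-prev-suc : ∀ {v i} → toℕ v ≡ suc i → toℕ (prev v) ≡ i
  toℕ-prev-suc {v} {i} v≡1+i = begin
    toℕ (prev v)        ≡⟨ toℕ-prev v ⟩
    (toℕ v + m) % suc m ≡⟨ cong (λ x → (x + m) % suc m) v≡1+i ⟩
    (suc i + m) % suc m ≡⟨ cong (_% suc m) (sym (+-suc i m)) ⟩
    (i + suc m) % suc m ≡⟨ [m+n]%n≡m%n i (suc m) ⟩
    i % suc m           ≡⟨ m<n⇒m%n≡m (<-trans (n<1+n i) (subst (_< suc m) v≡1+i (toℕ<n v))) ⟩
    i                   ∎
    where open ≡-Reasoning

  next-inject₁ : ∀ (w : Fin m) → next (inject₁ w) ≡ Fin.suc w
  next-inject₁ w = toℕ-injective (trans (toℕ-next-≢ w≢m) (cong suc (toℕ-inject₁ w)))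
    where
    w≢m : toℕ (inject₁ w) ≢ m
    w≢m = <⇒≢ (subst (_< m) (sym (toℕ-inject₁ w)) (toℕ<n w))

  next-fromℕ : next (fromℕ m) ≡ 0F
  next-fromℕ = toℕ-injective (toℕ-next-≡ (toℕ-fromℕ m))

  ∑-next : ∀ (f : Fin (suc m) → ℕ) → ∑[ v < suc m ] f (next v) ≡ ∑[ v < suc m ] f v
  ∑-next f = begin
    ∑[ v < suc m ] f (next v)                            ≡⟨ sum-init-last (f ∘ next) ⟩
    ∑[ w < m ] f (next (inject₁ w)) + f (next (fromℕ m)) ≡⟨ cong₂ _+_ (sum-cong-≗ (cong f ∘ next-inject₁))
                                                                      (cong f next-fromℕ) ⟩
    ∑[ w < m ] f (Fin.suc w) + f 0F                      ≡⟨ +-comm _ (f 0F) ⟩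
    ∑[ v < suc m ] f v                                   ∎
    where open ≡-Reasoning

  ∑-prev : ∀ (f : Fin (suc m) → ℕ) → ∑[ v < suc m ] f (prev v) ≡ ∑[ v < suc m ] f v
  ∑-prev f = trans (sym (∑-next (f ∘ prev))) (sum-cong-≗ (cong f ∘ prev-next))

  adjacent-next : ∀ v → Adj (Cycle (suc m)) v (next v)
  adjacent-next v = inj₁ (sym (toℕ-next v))

  adjacent-prev : ∀ v → Adj (Cycle (suc m)) v (prev v)
  adjacent-prev v = inj₂ (trans (sym (toℕ-next (prev v))) (cong toℕ (next-prev v)))

  adjacent⇒next⊎prev : ∀ {v u} → Adj (Cycle (suc m)) v u → u ≡ next v ⊎ u ≡ prev v
  adjacent⇒next⊎prev {v} (inj₁ e) = inj₁ (toℕ-injective (trans (sym e) (sym (toℕ-next v))))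
  adjacent⇒next⊎prev {u = u} (inj₂ e) =
    inj₂ (trans (sym (prev-next u)) (cong prev (toℕ-injective (trans (toℕ-next u) e))))

neighbourSum : ∀ {m} → (Fin (suc m) → ℕ) → Fin (suc m) → ℕ
neighbourSum f v = f (prev v) + f (next v)

∑-neighbourSum-+ : ∀ {m} (f g : Fin (suc m) → ℕ) →
  ∑[ v < suc m ] (neighbourSum f v + g v) ≡ 2 * ∑[ v < suc m ] f v + ∑[ v < suc m ] g v
∑-neighbourSum-+ {m} f g = begin
  ∑[ v < suc m ] (neighbourSum f v + g v)
    ≡⟨ ∑-distrib-+ (neighbourSum f) g ⟩
  ∑[ v < suc m ] neighbourSum f v + ∑g
    ≡⟨ cong (_+ ∑g) (∑-distrib-+ (f ∘ prev) (f ∘ next)) ⟩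
  (∑[ v < suc m ] f (prev v) + ∑[ v < suc m ] f (next v)) + ∑g
    ≡⟨ cong (_+ ∑g) (cong₂ _+_ (∑-prev f) (∑-next f)) ⟩
  (∑f + ∑f) + ∑g
    ≡⟨ cong (λ x → (∑f + x) + ∑g) (sym (+-identityʳ ∑f)) ⟩
  2 * ∑f + ∑g
    ∎
  where
  open ≡-Reasoning
  ∑f = ∑[ v < suc m ] f v
  ∑g = ∑[ v < suc m ] g v

∑-lowerBound : ∀ {n} c (f : Fin n → ℕ) → (∀ i → c ≤ f i) → n * c ≤ ∑[ i < n ] f i
∑-lowerBound {zero}  c f c≤f = z≤n
∑-lowerBound {suc n} c f c≤f = +-mono-≤ (c≤f 0F) (∑-lowerBound c (f ∘ Fin.suc) (c≤f ∘ Fin.suc))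

adjacent-T⇒1≤neighbourSum : ∀ {m} (S : Fin (suc m) → Bool) {v u} →
  Adj (Cycle (suc m)) v u → T (S u) → 1 ≤ neighbourSum (indicator ∘ S) v
adjacent-T⇒1≤neighbourSum S adj u∈S with adjacent⇒next⊎prev adj
... | inj₁ refl = T⇒1≤n+indicator _ u∈S
... | inj₂ refl = ≤-trans (≤-reflexive (sym (T⇒indicator≡1 u∈S))) (m≤m+n _ _)

cycle-domination-lowerBound : ∀ m (S : VSet (Cycle (suc m))) →
  Dominating (Cycle (suc m)) S → suc m ≤ 3 * size (Cycle (suc m)) S
cycle-domination-lowerBound m S dom = begin
  suc m                                   ≡⟨ *-identityʳ (suc m) ⟨
  suc m * 1                               ≤⟨ ∑-lowerBound 1 _ covered ⟩
  ∑[ v < suc m ] (neighbourSum χ v + χ v) ≡⟨ ∑-neighbourSum-+ χ χ ⟩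
  2 * ∑χ + ∑χ                             ≡⟨ +-comm (2 * ∑χ) ∑χ ⟩
  3 * ∑χ                                  ≡⟨ cong (3 *_) (size-Cycle m S) ⟨
  3 * size (Cycle (suc m)) S              ∎
  where
  open ≤-Reasoning
  χ = indicator ∘ S
  ∑χ = ∑[ v < suc m ] χ v
  covered : ∀ v → 1 ≤ neighbourSum χ v + χ v
  covered v with dom v
  ... | inj₁ v∈S             = T⇒1≤n+indicator (neighbourSum χ v) v∈S
  ... | inj₂ (u , u∈S , adj) = ≤-trans (adjacent-T⇒1≤neighbourSum S adj u∈S) (m≤m+n _ _)

prism-totalDomination-lowerBound : ∀ m (S : VSet (Prism (Cycle (suc m)))) →
  TotalDominating (Prism (Cycle (suc m))) S → suc m * 2 ≤ 3 * size (Prism (Cycle (suc m))) S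
prism-totalDomination-lowerBound m S dom = begin
  suc m * 2
    ≤⟨ ∑-lowerBound 2 _ covered ⟩
  ∑[ v < suc m ] ((neighbourSum a v + b v) + (neighbourSum b v + a v))
    ≡⟨ ∑-distrib-+ (λ v → neighbourSum a v + b v) (λ v → neighbourSum b v + a v) ⟩
  ∑[ v < suc m ] (neighbourSum a v + b v) + ∑[ v < suc m ] (neighbourSum b v + a v)
    ≡⟨ cong₂ _+_ (∑-neighbourSum-+ a b) (∑-neighbourSum-+ b a) ⟩
  (2 * ∑a + ∑b) + (2 * ∑b + ∑a)
    ≡⟨ regroup ∑a ∑b ⟩
  3 * (∑a + ∑b)
    ≡⟨ cong (3 *_) size≡∑a+∑b ⟨
  3 * size (Prism (Cycle (suc m))) S
    ∎
  where
  open ≤-Reasoning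
  a b : Fin (suc m) → ℕ
  a = indicator ∘ S ∘ inj₁
  b = indicator ∘ S ∘ inj₂
  ∑a = ∑[ v < suc m ] a v
  ∑b = ∑[ v < suc m ] b v
  regroup : ∀ x y → (2 * x + y) + (2 * y + x) ≡ 3 * (x + y)
  regroup = solve-∀
  size≡∑a+∑b : size (Prism (Cycle (suc m))) S ≡ ∑a + ∑b
  size≡∑a+∑b = trans (size-Prism (Cycle (suc m)) S)
                     (cong₂ _+_ (size-Cycle m (S ∘ inj₁)) (size-Cycle m (S ∘ inj₂)))
  top : ∀ v → 1 ≤ neighbourSum a v + b v
  top v with dom (inj₁ v)
  ... | inj₁ _ , u∈S , left adj = ≤-trans (adjacent-T⇒1≤neighbourSum (S ∘ inj₁) adj u∈S) (m≤m+n _ _)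
  ... | inj₂ _ , v∈S , rung₁    = T⇒1≤n+indicator (neighbourSum a v) v∈S
  bottom : ∀ v → 1 ≤ neighbourSum b v + a v
  bottom v with dom (inj₂ v)
  ... | inj₂ _ , u∈S , right adj = ≤-trans (adjacent-T⇒1≤neighbourSum (S ∘ inj₂) adj u∈S) (m≤m+n _ _)
  ... | inj₁ _ , v∈S , rung₂     = T⇒1≤n+indicator (neighbourSum b v) v∈S
  covered : ∀ v → 2 ≤ (neighbourSum a v + b v) + (neighbourSum b v + a v)
  covered v = +-mono-≤ (top v) (bottom v)

periodic : ∀ {A : Set} (f : ℕ → A) p → (∀ x → f (p + x) ≡ f x) → ∀ r q → f (r + q * p) ≡ f r
periodic f p per r zero    = cong f (+-identityʳ r)
periodic f p per r (suc q) = begin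
  f (r + (p + q * p)) ≡⟨ cong f (trans (sym (+-assoc r p _)) (trans (cong (_+ q * p) (+-comm r p)) (+-assoc p r _))) ⟩
  f (p + (r + q * p)) ≡⟨ per (r + q * p) ⟩
  f (r + q * p)       ≡⟨ periodic f p per r q ⟩
  f r                 ∎
  where open ≡-Reasoning

T-periodic : ∀ {f : ℕ → Bool} {p} → (∀ x → f (p + x) ≡ f x) →
  ∀ r q {j} → j ≡ r + q * p → T (f r) → T (f j)
T-periodic {f} {p} per r q j≡r+qp = subst T (sym (trans (cong f j≡r+qp) (periodic f p per r q)))

residue≢0⇒≢multiple : ∀ {n} .{{_ : NonZero n}} {i m} r q →
  r % n ≢ 0 → n ∣ m → i ≡ r + q * n → i ≢ m
residue≢0⇒≢multiple {n} r q r%n≢0 (divides p m≡pn) i≡r+qn i≡m = r%n≢0 (begin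
  r % n           ≡⟨ [m+kn]%n≡m%n r q n ⟨
  (r + q * n) % n ≡⟨ cong (_% n) (trans (sym i≡r+qn) (trans i≡m m≡pn)) ⟩
  (p * n) % n     ≡⟨ m*n%n≡0 p n ⟩
  0               ∎)
  where open ≡-Reasoning

∈-next : ∀ {m} (f : ℕ → Bool) (v : Fin (suc m)) →
  (toℕ v ≡ m → T (f 0)) → (toℕ v ≢ m → T (f (suc (toℕ v)))) → T (f (toℕ (next v)))
∈-next {m} f v wrap step with toℕ v ≟ m
... | yes v≡m = subst (T ∘ f) (sym (toℕ-next-≡ v≡m)) (wrap v≡m)
... | no  v≢m = subst (T ∘ f) (sym (toℕ-next-≢ v≢m)) (step v≢m)

∈-prev : ∀ {m} (f : ℕ → Bool) {v : Fin (suc m)} {i} → toℕ v ≡ suc i → T (f i) → T (f (toℕ (prev v)))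
∈-prev f v≡1+i = subst (T ∘ f) (sym (toℕ-prev-suc v≡1+i))

everyThird : ℕ → Bool
everyThird 0                   = true
everyThird 1                   = false
everyThird 2                   = false
everyThird (suc (suc (suc i))) = everyThird i

∈everyThird : ∀ r q {j} → j ≡ r + q * 3 → T (everyThird r) → T (everyThird j)
∈everyThird = T-periodic (λ _ → refl)

everyThird-dominating : ∀ m → Dominating (Cycle (suc m)) (everyThird ∘ toℕ)
everyThird-dominating m v with toℕ v divMod 3
... | result q 0F v≡ = inj₁ (∈everyThird 0 q v≡ tt)
... | result q 1F v≡ = inj₂ (prev v , ∈-prev everyThird v≡ (∈everyThird 0 q refl tt) , adjacent-prev v)
... | result q 2F v≡ = inj₂ (next v ,
        ∈-next everyThird v (λ _ → tt) (λ _ → ∈everyThird 0 (suc q) (cong suc v≡) tt) ,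
        adjacent-next v)

prismTop prismBottom : ℕ → Bool
prismTop 0 = true
prismTop 1 = true
prismTop 2 = false
prismTop 3 = false
prismTop 4 = false
prismTop 5 = false
prismTop (suc (suc (suc (suc (suc (suc i)))))) = prismTop i
prismBottom 0 = false
prismBottom 1 = false
prismBottom 2 = false
prismBottom 3 = true
prismBottom 4 = true
prismBottom 5 = false
prismBottom (suc (suc (suc (suc (suc (suc i)))))) = prismBottom i

prismSet : ∀ {n} → Fin n ⊎ Fin n → Bool
prismSet (inj₁ v) = prismTop (toℕ v)
prismSet (inj₂ v) = prismBottom (toℕ v)

∈prismTop : ∀ r q {j} → j ≡ r + q * 6 → T (prismTop r) → T (prismTop j)
∈prismTop = T-periodic (λ _ → refl)

∈prismBottom : ∀ r q {j} → j ≡ r + q * 6 → T (prismBottom r) → T (prismBottom j)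
∈prismBottom = T-periodic (λ _ → refl)

prismSet-totalDominating : ∀ m → 6 ∣ m → TotalDominating (Prism (Cycle (suc m))) prismSet
prismSet-totalDominating m _ (inj₁ v) with toℕ v divMod 6
... | result q 0F v≡ = inj₁ (next v) ,
        ∈-next prismTop v (λ _ → tt) (λ _ → ∈prismTop 1 q (cong suc v≡) tt) , left (adjacent-next v)
... | result q 1F v≡ = inj₁ (prev v) , ∈-prev prismTop v≡ (∈prismTop 0 q refl tt) , left (adjacent-prev v)
... | result q 2F v≡ = inj₁ (prev v) , ∈-prev prismTop v≡ (∈prismTop 1 q refl tt) , left (adjacent-prev v)
... | result q 3F v≡ = inj₂ v , ∈prismBottom 3 q v≡ tt , rung₁
... | result q 4F v≡ = inj₂ v , ∈prismBottom 4 q v≡ tt , rung₁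
... | result q 5F v≡ = inj₁ (next v) ,
        ∈-next prismTop v (λ _ → tt) (λ _ → ∈prismTop 0 (suc q) (cong suc v≡) tt) , left (adjacent-next v)
prismSet-totalDominating m 6∣m (inj₂ v) with toℕ v divMod 6
... | result q 0F v≡ = inj₁ v , ∈prismTop 0 q v≡ tt , rung₂
... | result q 1F v≡ = inj₁ v , ∈prismTop 1 q v≡ tt , rung₂
... | result q 2F v≡ = inj₂ (next v) ,
        ∈-next prismBottom v (⊥-elim ∘ residue≢0⇒≢multiple 2 q (λ ()) 6∣m v≡)
                             (λ _ → ∈prismBottom 3 q (cong suc v≡) tt) ,
        right (adjacent-next v)
... | result q 3F v≡ = inj₂ (next v) ,
        ∈-next prismBottom v (⊥-elim ∘ residue≢0⇒≢multiple 3 q (λ ()) 6∣m v≡)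
                             (λ _ → ∈prismBottom 4 q (cong suc v≡) tt) ,
        right (adjacent-next v)
... | result q 4F v≡ = inj₂ (prev v) , ∈-prev prismBottom v≡ (∈prismBottom 3 q refl tt) , right (adjacent-prev v)
... | result q 5F v≡ = inj₂ (prev v) , ∈-prev prismBottom v≡ (∈prismBottom 4 q refl tt) , right (adjacent-prev v)

-- The hypothesis holds by computation for the periodic patterns above, as ∑ unfolds six terms.
∑-6-periodic : ∀ (f : ℕ → ℕ) c →
  (∀ n → ∑[ v < suc (6 + n) ] f (toℕ v) ≡ c + ∑[ v < suc n ] f (toℕ v)) →
  ∀ k → ∑[ v < suc (6 * k) ] f (toℕ v) ≡ k * c + f 0
∑-6-periodic f c step zero    = +-identityʳ (f 0)
∑-6-periodic f c step (suc k) = begin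
  ∑[ v < suc (6 * suc k) ] f (toℕ v) ≡⟨ cong (λ n → ∑[ v < suc n ] f (toℕ v)) (*-suc 6 k) ⟩
  ∑[ v < suc (6 + 6 * k) ] f (toℕ v) ≡⟨ step (6 * k) ⟩
  c + ∑[ v < suc (6 * k) ] f (toℕ v) ≡⟨ cong (c +_) (∑-6-periodic f c step k) ⟩
  c + (k * c + f 0)                  ≡⟨ +-assoc c (k * c) (f 0) ⟨
  suc k * c + f 0                    ∎
  where open ≡-Reasoning

size-everyThird : ∀ k → size (Cycle (suc (6 * k))) (everyThird ∘ toℕ) ≡ suc (2 * k)
size-everyThird k = begin
  size (Cycle (suc (6 * k))) (everyThird ∘ toℕ)        ≡⟨ size-Cycle (6 * k) (everyThird ∘ toℕ) ⟩
  ∑[ v < suc (6 * k) ] indicator (everyThird (toℕ v)) ≡⟨ ∑-6-periodic (indicator ∘ everyThird) 2 (λ _ → refl) k ⟩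
  k * 2 + 1                                            ≡⟨ k*2+1≡1+2k k ⟩
  suc (2 * k)                                          ∎
  where
  open ≡-Reasoning
  k*2+1≡1+2k : ∀ k → k * 2 + 1 ≡ suc (2 * k)
  k*2+1≡1+2k = solve-∀

size-prismSet : ∀ k → size (Prism (Cycle (suc (6 * k)))) prismSet ≡ suc (2 * k) + 2 * k
size-prismSet k = begin
  size (Prism C) prismSet
    ≡⟨ size-Prism C prismSet ⟩
  size C (prismTop ∘ toℕ) + size C (prismBottom ∘ toℕ)
    ≡⟨ cong₂ _+_ (size-Cycle (6 * k) (prismTop ∘ toℕ)) (size-Cycle (6 * k) (prismBottom ∘ toℕ)) ⟩
  ∑[ v < suc (6 * k) ] indicator (prismTop (toℕ v)) + ∑[ v < suc (6 * k) ] indicator (prismBottom (toℕ v))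
    ≡⟨ cong₂ _+_ (∑-6-periodic (indicator ∘ prismTop) 2 (λ _ → refl) k)
                 (∑-6-periodic (indicator ∘ prismBottom) 2 (λ _ → refl) k) ⟩
  (k * 2 + 1) + (k * 2 + 0)
    ≡⟨ regroup k ⟩
  suc (2 * k) + 2 * k
    ∎
  where
  open ≡-Reasoning
  C = Cycle (suc (6 * k))
  regroup : ∀ k → (k * 2 + 1) + (k * 2 + 0) ≡ suc (2 * k) + 2 * k
  regroup = solve-∀

1+6k≤3s⇒1+2k≤s : ∀ k s → suc (6 * k) ≤ 3 * s → suc (2 * k) ≤ s
1+6k≤3s⇒1+2k≤s k s 1+6k≤3s = *-cancelˡ-< 3 (2 * k) s (≤-trans (s≤s (≤-reflexive (3*2k≡6k k))) 1+6k≤3s)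
  where
  3*2k≡6k : ∀ k → 3 * (2 * k) ≡ 6 * k
  3*2k≡6k = solve-∀

[1+6k]*2≤3s⇒[1+2k]+2k≤s : ∀ k s → suc (6 * k) * 2 ≤ 3 * s → suc (2 * k) + 2 * k ≤ s
[1+6k]*2≤3s⇒[1+2k]+2k≤s k s [1+6k]*2≤3s =
  *-cancelˡ-< 3 (2 * k + 2 * k) s (≤-trans (s≤s (≤-trans (≤-reflexive (3*4k≡6k*2 k)) (n≤1+n _))) [1+6k]*2≤3s)
  where
  3*4k≡6k*2 : ∀ k → 3 * (2 * k + 2 * k) ≡ 6 * k * 2
  3*4k≡6k*2 = solve-∀

2*[1+n]∸1≡[1+n]+n : ∀ n → 2 * suc n ∸ 1 ≡ suc n + n
2*[1+n]∸1≡[1+n]+n n = trans (+-suc n (n + 0)) (cong (λ x → suc (n + x)) (+-identityʳ n))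

proposition1 : (k : ℕ) → 1 ≤ k →
    ∃ λ g → IsDominationNumber (Cycle (suc (6 * k))) g ×
            IsTotalDominationNumber (Prism (Cycle (suc (6 * k)))) (2 * g ∸ 1)
proposition1 k _ = suc (2 * k) , γ , γₜ
  where
  γ : IsDominationNumber (Cycle (suc (6 * k))) (suc (2 * k))
  γ = (everyThird ∘ toℕ , everyThird-dominating (6 * k) , size-everyThird k) ,
      λ S dom → 1+6k≤3s⇒1+2k≤s k _ (cycle-domination-lowerBound (6 * k) S dom)
  γₜ : IsTotalDominationNumber (Prism (Cycle (suc (6 * k)))) (2 * suc (2 * k) ∸ 1)
  γₜ = subst (IsTotalDominationNumber (Prism (Cycle (suc (6 * k))))) (sym (2*[1+n]∸1≡[1+n]+n (2 * k)))
         ( (prismSet , prismSet-totalDominating (6 * k) (divides k (*-comm 6 k)) , size-prismSet k)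
         , λ S tdom → [1+6k]*2≤3s⇒[1+2k]+2k≤s k _ (prism-totalDomination-lowerBound (6 * k) S tdom))
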